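{- $\rho_T(2K_2)=2$, where $2K_2$ is the graph consisting of two disjoint edges (four vertices, two edges with no common endpoint).
   Context: Graphs are finite and simple. For $u,v\in(\mathbb{R}\cup\{\infty\})^k$, $u\odot v=\min_i(u_i+v_i)$. $\rho_T(G)$ is the minimum $k$ such that there is $f:V(G)\to(\mathbb{R}\cup\{\infty\})^k$ and a threshold $t>0$ with, for all distinct $x,y$, $xy\in E(G)$ iff $f(x)\odot f(y)\ge t$. -}

module Defs where

open import Data.Nat using (ℕ; zero; suc) renaming (_<_ to _<ℕ_)
open import Data.Fin using (Fin; zero; suc)
open import Data.Vec using (Vec; []; _∷_; lookup)
open import Data.Sum using (_⊎_; inj₁; inj₂)
open import Data.Product using (Σ; _×_; _,_; ∃)
open import Data.Empty using (⊥)
open import Data.Unit using (⊤)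
open import Relation.Nullary using (¬_)
open import Relation.Binary.PropositionalEquality using (_≡_)

-- The real numbers, given axiomatically as a complete ordered field.
-- (agda-stdlib has no reals; any two complete ordered fields are
-- isomorphic, so quantifying over all of them is faithful.)

record RealNumbers : Set₁ where
  infixl 6 _+_
  infixl 7 _*_
  infix 4 _≤_ _<_

  field
    ℝ     : Set
    _+_   : ℝ → ℝ → ℝ
    _*_   : ℝ → ℝ → ℝ
    -_    : ℝ → ℝ
    0ℝ    : ℝ
    1ℝ    : ℝ
    _⁻¹   : (x : ℝ) → ¬ (x ≡ 0ℝ) → ℝ
    _≤_   : ℝ → ℝ → Set
    +-assoc   : ∀ x y z → (x + y) + z ≡ x + (y + z)
    +-comm    : ∀ x y → x + y ≡ y + x
    +-idʳ     : ∀ x → x + 0ℝ ≡ x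
    +-invʳ    : ∀ x → x + (- x) ≡ 0ℝ
    *-assoc   : ∀ x y z → (x * y) * z ≡ x * (y * z)
    *-comm    : ∀ x y → x * y ≡ y * x
    *-idʳ     : ∀ x → x * 1ℝ ≡ x
    *-invʳ    : ∀ x (p : ¬ (x ≡ 0ℝ)) → x * (x ⁻¹) p ≡ 1ℝ
    distrib   : ∀ x y z → x * (y + z) ≡ x * y + x * z
    0≢1       : ¬ (0ℝ ≡ 1ℝ)
    ≤-refl    : ∀ x → x ≤ x
    ≤-antisym : ∀ {x y} → x ≤ y → y ≤ x → x ≡ y
    ≤-trans   : ∀ {x y z} → x ≤ y → y ≤ z → x ≤ z
    ≤-total   : ∀ x y → x ≤ y ⊎ y ≤ x
    +-mono-≤  : ∀ {x y} z → x ≤ y → x + z ≤ y + z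
    *-nonneg  : ∀ {x y} → 0ℝ ≤ x → 0ℝ ≤ y → 0ℝ ≤ x * y
    sup : (S : ℝ → Set) → (∃ λ x → S x) → (∃ λ b → ∀ x → S x → x ≤ b) →
          ∃ λ s → (∀ x → S x → x ≤ s) × (∀ b → (∀ x → S x → x ≤ b) → s ≤ b)

  _<_ : ℝ → ℝ → Set
  x < y = x ≤ y × ¬ (x ≡ y)

module Tropical (R : RealNumbers) where
  open RealNumbers R

  data ℝ∞ : Set where
    fin : ℝ → ℝ∞
    ∞   : ℝ∞

  _⊕_ : ℝ∞ → ℝ∞ → ℝ∞
  fin x ⊕ fin y = fin (x + y)
  fin x ⊕ ∞     = ∞
  ∞     ⊕ _     = ∞

  min∞ : ℝ∞ → ℝ∞ → ℝ∞
  min∞ (fin x) (fin y) with ≤-total x y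
  ... | inj₁ _ = fin x
  ... | inj₂ _ = fin y
  min∞ (fin x) ∞ = fin x
  min∞ ∞ v = v

  _≤∞_ : ℝ∞ → ℝ∞ → Set
  fin x ≤∞ fin y = x ≤ y
  fin x ≤∞ ∞     = ⊤
  ∞     ≤∞ fin y = ⊥
  ∞     ≤∞ ∞     = ⊤

  _⊙_ : ∀ {k} → Vec ℝ∞ k → Vec ℝ∞ k → ℝ∞
  [] ⊙ [] = ∞
  (a ∷ u) ⊙ (b ∷ v) = min∞ (a ⊕ b) (u ⊙ v)

  -- A graph on vertex set Fin n is given by its (symmetric, irreflexive)
  -- adjacency relation.  A tropical representation in dimension k.
  Representable : ∀ {n} → (Fin n → Fin n → Set) → ℕ → Set
  Representable {n} E k =
    Σ (Fin n → Vec ℝ∞ k) λ f → Σ ℝ λ t → (0ℝ < t) ×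
      (∀ x y → ¬ (x ≡ y) → (E x y → fin t ≤∞ (f x ⊙ f y))
                          × (fin t ≤∞ (f x ⊙ f y) → E x y))

  ρT≡ : ∀ {n} → (Fin n → Fin n → Set) → ℕ → Set
  ρT≡ E m = Representable E m × (∀ k → k <ℕ m → ¬ Representable E k)

2K₂ : Fin 4 → Fin 4 → Set
2K₂ zero (suc zero) = ⊤
2K₂ (suc zero) zero = ⊤
2K₂ (suc (suc zero)) (suc (suc (suc zero))) = ⊤
2K₂ (suc (suc (suc zero))) (suc (suc zero)) = ⊤
2K₂ _ _ = ⊥

-- In dimension one the product u ⊙ v is the plain sum u + v, and two edges
-- xy, zw then force an edge across them: from t ≤ x + y and t ≤ z + w we get
-- t + t ≤ (x + z) + (y + w), so x + z ≥ t or y + w ≥ t.  Dimension zero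
-- fails since every product is the empty minimum ∞.  In dimension two the two
-- coordinates separate the two edges: the vectors (1,1), (1,1), (0,∞), (∞,0)
-- with threshold 1 + 1.
module Submission where

open import Defs
open import Level using (0ℓ)
open import Algebra.Bundles using (Ring)
import Algebra.Properties.Ring as RingProperties
import Algebra.Properties.CommutativeSemigroup as CommutativeSemigroupProperties
open import Data.Nat using (zero; suc; s≤s) renaming (_<_ to _<ℕ_)
open import Data.Fin using (Fin; zero; suc)
open import Data.Vec using (Vec; []; _∷_)
open import Data.Sum using (_⊎_; inj₁; inj₂)
open import Data.Product using (_×_; _,_; proj₁; proj₂)
open import Data.Empty using (⊥-elim)
open import Data.Unit using (tt)
open import Function using (_∘_)
open import Relation.Nullary using (¬_)
open import Relation.Binary.PropositionalEquality
  using (_≡_; _≢_; refl; sym; trans; cong; cong₂; subst₂; isEquivalence)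

module OrderedField (R : RealNumbers) where
  open RealNumbers R

  open import Algebra.Structures {A = ℝ} _≡_ using (IsCommutativeMonoid)
  open import Algebra.Structures.Biased {A = ℝ} _≡_ using (isCommutativeMonoidʳ)
  open import Algebra.Consequences.Propositional {A = ℝ}
    using (comm∧idʳ⇒id; comm∧invʳ⇒inv; comm∧distrˡ⇒distrʳ)

  +-isCommutativeMonoid : IsCommutativeMonoid _+_ 0ℝ
  +-isCommutativeMonoid = isCommutativeMonoidʳ record
    { isSemigroup = record
      { isMagma = record { isEquivalence = isEquivalence ; ∙-cong = cong₂ _+_ }
      ; assoc   = +-assoc
      }
    ; identityʳ = +-idʳ
    ; comm      = +-comm
    }

  ring : Ring 0ℓ 0ℓ
  ring = record
    { Carrier = ℝ ; _≈_ = _≡_ ; _+_ = _+_ ; _*_ = _*_ ; -_ = -_ ; 0# = 0ℝ ; 1# = 1ℝ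
    ; isRing = record
      { +-isAbelianGroup = record
        { isGroup = record
          { isMonoid = IsCommutativeMonoid.isMonoid +-isCommutativeMonoid
          ; inverse  = comm∧invʳ⇒inv +-comm +-invʳ
          ; ⁻¹-cong  = cong -_
          }
        ; comm = +-comm
        }
      ; *-cong     = cong₂ _*_
      ; *-assoc    = *-assoc
      ; *-identity = comm∧idʳ⇒id *-comm *-idʳ
      ; distrib    = distrib , comm∧distrˡ⇒distrʳ *-comm distrib
      }
    }

  open RingProperties ring using (-1*x≈-x; -‿involutive)
  open CommutativeSemigroupProperties (Ring.+-commutativeSemigroup ring) using (interchange)

  +-monoʳ-≤ : ∀ {x y} z → x ≤ y → z + x ≤ z + y
  +-monoʳ-≤ {x} {y} z x≤y = subst₂ _≤_ (+-comm x z) (+-comm y z) (+-mono-≤ z x≤y)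

  +-mono-≤₂ : ∀ {x y z w} → x ≤ y → z ≤ w → x + z ≤ y + w
  +-mono-≤₂ {y = y} {z} x≤y z≤w = ≤-trans (+-mono-≤ z x≤y) (+-monoʳ-≤ y z≤w)

  +-cancelʳ-≤ : ∀ {x y} z → x + z ≤ y + z → x ≤ y
  +-cancelʳ-≤ {x} {y} z x+z≤y+z =
    subst₂ _≤_ (x+z-z≡x x) (x+z-z≡x y) (+-mono-≤ (- z) x+z≤y+z)
    where
    x+z-z≡x : ∀ x → x + z + - z ≡ x
    x+z-z≡x x = trans (+-assoc x z (- z)) (trans (cong (x +_) (+-invʳ z)) (+-idʳ x))

  -- If 1 ≤ 0 then 0 ≤ -1, and so 0 ≤ (-1)(-1) = 1 all the same.
  0≤1 : 0ℝ ≤ 1ℝ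
  0≤1 with ≤-total 0ℝ 1ℝ
  ... | inj₁ 0≤1 = 0≤1
  ... | inj₂ 1≤0 = subst₂ _≤_ refl -1*-1≡1 (*-nonneg 0≤-1 0≤-1)
    where
    0≤-1 : 0ℝ ≤ - 1ℝ
    0≤-1 = subst₂ _≤_ (+-invʳ 1ℝ) (Ring.+-identityˡ ring (- 1ℝ)) (+-mono-≤ (- 1ℝ) 1≤0)
    -1*-1≡1 : - 1ℝ * - 1ℝ ≡ 1ℝ
    -1*-1≡1 = trans (-1*x≈-x (- 1ℝ)) (-‿involutive 1ℝ)

  1≰0 : ¬ (1ℝ ≤ 0ℝ)
  1≰0 1≤0 = 0≢1 (≤-antisym 0≤1 1≤0)

  0<1+1 : 0ℝ < 1ℝ + 1ℝ
  0<1+1 = subst₂ _≤_ (+-idʳ 0ℝ) refl (+-mono-≤₂ 0≤1 0≤1) , 0≢1+1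
    where
    0≢1+1 : 0ℝ ≢ 1ℝ + 1ℝ
    0≢1+1 0≡1+1 = 1≰0 (subst₂ _≤_ (+-idʳ 1ℝ) (sym 0≡1+1) (+-monoʳ-≤ 1ℝ 0≤1))

  ≤-exchange : ∀ {t} a b c d → t ≤ a + b → t ≤ c + d → t ≤ a + c ⊎ t ≤ b + d
  ≤-exchange {t} a b c d t≤a+b t≤c+d with ≤-total t (b + d)
  ... | inj₁ t≤b+d = inj₂ t≤b+d
  ... | inj₂ b+d≤t = inj₁ (+-cancelʳ-≤ t (≤-trans (+-mono-≤₂ t≤a+b t≤c+d)
          (subst₂ _≤_ (sym (interchange a b c d)) refl (+-monoʳ-≤ (a + c) b+d≤t))))

module TropicalProperties (R : RealNumbers) where
  open RealNumbers R
  open Tropical R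
  open OrderedField R

  min∞-identityʳ : ∀ u → min∞ u ∞ ≡ u
  min∞-identityʳ (fin x) = refl
  min∞-identityʳ ∞       = refl

  min∞-glb : ∀ {t} u v → fin t ≤∞ u → fin t ≤∞ v → fin t ≤∞ min∞ u v
  min∞-glb (fin x) (fin y) t≤x t≤y with ≤-total x y
  ... | inj₁ _ = t≤x
  ... | inj₂ _ = t≤y
  min∞-glb (fin x) ∞ t≤x _   = t≤x
  min∞-glb ∞       v _   t≤v = t≤v

  ⊙₀-top : ∀ {t} (u v : Vec ℝ∞ 0) → fin t ≤∞ (u ⊙ v)
  ⊙₀-top [] [] = tt

  ≤∞-exchange : ∀ {t} a b c d → fin t ≤∞ (a ⊕ b) → fin t ≤∞ (c ⊕ d) →
                fin t ≤∞ (a ⊕ c) ⊎ fin t ≤∞ (b ⊕ d)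
  ≤∞-exchange ∞       b       c       d       _ _ = inj₁ tt
  ≤∞-exchange (fin a) b       ∞       d       _ _ = inj₁ tt
  ≤∞-exchange (fin a) ∞       (fin c) d       _ _ = inj₂ tt
  ≤∞-exchange (fin a) (fin b) (fin c) ∞       _ _ = inj₂ tt
  ≤∞-exchange (fin a) (fin b) (fin c) (fin d)     = ≤-exchange a b c d

  ⊙-exchange₁ : ∀ {t} (u v w s : Vec ℝ∞ 1) → fin t ≤∞ (u ⊙ v) → fin t ≤∞ (w ⊙ s) →
                fin t ≤∞ (u ⊙ w) ⊎ fin t ≤∞ (v ⊙ s)
  ⊙-exchange₁ (a ∷ []) (b ∷ []) (c ∷ []) (d ∷ [])
    rewrite min∞-identityʳ (a ⊕ b) | min∞-identityʳ (c ⊕ d)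
          | min∞-identityʳ (a ⊕ c) | min∞-identityʳ (b ⊕ d) = ≤∞-exchange a b c d

  non-edge⇒¬Representable₀ : ∀ {n} {E : Fin n → Fin n → Set} {x y : Fin n} →
                             x ≢ y → ¬ E x y → ¬ Representable E 0
  non-edge⇒¬Representable₀ {x = x} {y} x≢y ¬Exy (f , t , _ , represents) =
    ¬Exy (proj₂ (represents x y x≢y) (⊙₀-top (f x) (f y)))

  induced-2K₂⇒¬Representable₁ :
    ∀ {n} {E : Fin n → Fin n → Set} {x y z w : Fin n} →
    x ≢ y → z ≢ w → x ≢ z → y ≢ w →
    E x y → E z w → ¬ E x z → ¬ E y w → ¬ Representable E 1
  induced-2K₂⇒¬Representable₁ {x = x} {y} {z} {w}
    x≢y z≢w x≢z y≢w Exy Ezw ¬Exz ¬Eyw (f , t , _ , represents)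
    with ⊙-exchange₁ (f x) (f y) (f z) (f w)
           (proj₁ (represents x y x≢y) Exy) (proj₁ (represents z w z≢w) Ezw)
  ... | inj₁ t≤fx⊙fz = ¬Exz (proj₂ (represents x z x≢z) t≤fx⊙fz)
  ... | inj₂ t≤fy⊙fw = ¬Eyw (proj₂ (represents y w y≢w) t≤fy⊙fw)

module Representation2K₂ (R : RealNumbers) where
  open RealNumbers R
  open Tropical R
  open OrderedField R
  open TropicalProperties R

  f : Fin 4 → Vec ℝ∞ 2
  f zero                   = fin 1ℝ ∷ fin 1ℝ ∷ []
  f (suc zero)             = fin 1ℝ ∷ fin 1ℝ ∷ []
  f (suc (suc zero))       = fin 0ℝ ∷ ∞ ∷ []
  f (suc (suc (suc zero))) = ∞ ∷ fin 0ℝ ∷ []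

  2K₂-representable₂ : Representable 2K₂ 2
  2K₂-representable₂ = f , 1ℝ + 1ℝ , 0<1+1 , represents
    where
    edge : fin (1ℝ + 1ℝ) ≤∞ (f zero ⊙ f (suc zero))
    edge = min∞-glb _ _ (≤-refl _) (min∞-glb _ ∞ (≤-refl _) tt)

    1+1≰0+1 : ¬ (1ℝ + 1ℝ ≤ 0ℝ + 1ℝ)
    1+1≰0+1 = 1≰0 ∘ +-cancelʳ-≤ 1ℝ

    1+1≰1+0 : ¬ (1ℝ + 1ℝ ≤ 1ℝ + 0ℝ)
    1+1≰1+0 = 1+1≰0+1 ∘ subst₂ _≤_ refl (+-comm 1ℝ 0ℝ)

    represents : ∀ x y → x ≢ y →
                 (2K₂ x y → fin (1ℝ + 1ℝ) ≤∞ (f x ⊙ f y)) ×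
                 (fin (1ℝ + 1ℝ) ≤∞ (f x ⊙ f y) → 2K₂ x y)
    represents zero                   zero                   x≢x = ⊥-elim (x≢x refl)
    represents zero                   (suc zero)             _   = (λ _ → edge) , (λ _ → tt)
    represents zero                   (suc (suc zero))       _   = (λ ()) , 1+1≰1+0
    represents zero                   (suc (suc (suc zero))) _   = (λ ()) , 1+1≰1+0
    represents (suc zero)             zero                   _   = (λ _ → edge) , (λ _ → tt)
    represents (suc zero)             (suc zero)             x≢x = ⊥-elim (x≢x refl)
    represents (suc zero)             (suc (suc zero))       _   = (λ ()) , 1+1≰1+0
    represents (suc zero)             (suc (suc (suc zero))) _   = (λ ()) , 1+1≰1+0
    represents (suc (suc zero))       zero                   _   = (λ ()) , 1+1≰0+1
    represents (suc (suc zero))       (suc zero)             _   = (λ ()) , 1+1≰0+1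
    represents (suc (suc zero))       (suc (suc zero))       x≢x = ⊥-elim (x≢x refl)
    represents (suc (suc zero))       (suc (suc (suc zero))) _   = (λ _ → tt) , (λ _ → tt)
    represents (suc (suc (suc zero))) zero                   _   = (λ ()) , 1+1≰0+1
    represents (suc (suc (suc zero))) (suc zero)             _   = (λ ()) , 1+1≰0+1
    represents (suc (suc (suc zero))) (suc (suc zero))       _   = (λ _ → tt) , (λ _ → tt)
    represents (suc (suc (suc zero))) (suc (suc (suc zero))) x≢x = ⊥-elim (x≢x refl)

mainTheorem12 : (R : RealNumbers) → Tropical.ρT≡ R 2K₂ 2
mainTheorem12 R = 2K₂-representable₂ , not-representable-below-2
  where
  open Tropical R using (Representable)
  open TropicalProperties R
  open Representation2K₂ R using (2K₂-representable₂)

  not-representable-below-2 : ∀ k → k <ℕ 2 → ¬ Representable 2K₂ k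
  not-representable-below-2 zero _ =
    non-edge⇒¬Representable₀ {x = zero} {suc (suc zero)} (λ ()) (λ ())
  not-representable-below-2 (suc zero) _ =
    induced-2K₂⇒¬Representable₁ {x = zero} {suc zero} {suc (suc zero)} {suc (suc (suc zero))}
      (λ ()) (λ ()) (λ ()) (λ ()) tt tt (λ ()) (λ ())
  not-representable-below-2 (suc (suc k)) (s≤s (s≤s ()))
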